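{- Suppose that a connected graph $H$ contains the star $K_{1,4}$ as a subgraph but does not contain any subgraph isomorphic to $S_{4,4}$. Then $H$ contains a vertex of degree more than $(v(H)/2)^{1/7}$.
   Context: Graphs are finite, simple and undirected; $v(H)$ is the number of vertices of $H$; subgraphs are not necessarily induced. The sparkler graph $S_{4,4}$ is obtained from the star $K_{1,3}$ and the path $P_4$ on 4 vertices by adding an edge between an end vertex of $P_4$ and the central vertex of $K_{1,3}$. -}

module Defs where

open import Data.Nat using (ℕ; _<_; _*_; _^_)
open import Data.Bool using (Bool; true; false)
open import Data.Fin using (Fin; zero; suc)
open import Data.List using (List; []; _∷_; length; filter)
open import Data.List.Relation.Unary.All using (All)
open import Data.List using () renaming (allFin to allFinL)
open import Data.Product using (_×_; _,_; Σ; ∃)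
open import Relation.Binary.PropositionalEquality using (_≡_)
open import Relation.Nullary.Decidable.Core using (T?)
open import Function.Definitions using (Injective)
open import Data.Fin using (#_)

record Graph (n : ℕ) : Set where
  field
    adj   : Fin n → Fin n → Bool
    sym   : ∀ u v → adj u v ≡ adj v u
    irrefl : ∀ v → adj v v ≡ false
open Graph public

v : ∀ {n} → Graph n → ℕ
v {n} _ = n

degree : ∀ {n} → Graph n → Fin n → ℕ
degree {n} H x = length (filter (λ u → T? (adj H x u)) (allFinL n))

data Walk {n} (H : Graph n) : Fin n → Fin n → Set where
  here : ∀ {x} → Walk H x x
  step : ∀ {x y z} → adj H x y ≡ true → Walk H y z → Walk H x z

Connected : ∀ {n} → Graph n → Set
Connected H = ∀ x y → Walk H x y

Pattern : ℕ → Set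
Pattern k = List (Fin k × Fin k)

Contains : ∀ {n k} → Graph n → Pattern k → Set
Contains {n} {k} H F =
  Σ (Fin k → Fin n) λ f → Injective _≡_ _≡_ f × All (λ e → adj H (f (Data.Product.proj₁ e)) (f (Data.Product.proj₂ e)) ≡ true) F

K14 : Pattern 5
K14 = (# 0 , # 1) ∷ (# 0 , # 2) ∷ (# 0 , # 3) ∷ (# 0 , # 4) ∷ []

-- Sparkler S_{4,4}: K_{1,3} with centre 0 and leaves 1,2,3;
-- path P_4 = 4-5-6-7; extra edge between the end vertex 4 of P_4 and centre 0.
S44 : Pattern 8
S44 = (# 0 , # 1) ∷ (# 0 , # 2) ∷ (# 0 , # 3) ∷ (# 4 , # 5) ∷ (# 5 , # 6) ∷ (# 6 , # 7) ∷ (# 0 , # 4) ∷ []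

module Submission where

-- Let c be the centre of a K₁,₄ and suppose some vertex w lies at distance 4 from c,
-- reached by a shortest path c a b u w.  The vertices a, b, u, w are pairwise distinct
-- because their distances from c differ, and b, u, w lie outside the closed
-- neighbourhood of c; so c, three leaves of the star other than a, and the path
-- a b u w form an S₄,₄.  Hence, in an S₄,₄-free connected graph, every vertex is within
-- distance 3 of c, which gives v(H) ≤ (1 + Δ)³ < 2Δ⁷ for the maximum degree Δ ≥ 4.

open import Defs hiding (sym)
open import Data.Nat using (ℕ; _<_; _*_; _^_)
open import Data.Fin using (Fin)
open import Data.Product using (∃)
open import Relation.Nullary using (¬_)

open import Data.Bool using (true; T) renaming (_≟_ to _≟ᵇ_)
open import Data.Fin using (zero; suc; toℕ; splitAt; join; punchIn)
open import Data.Fin.Properties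
  using (any?; pigeonhole; <⇒≢; punchIn-injective; punchInᵢ≢i; suc-injective; toℕ-injective; join-splitAt)
  renaming (_≟_ to _≟ᶠ_)
import Data.List as List
open import Data.List using (List; _++_; concatMap; filter; length)
open import Data.List.Membership.Propositional using (_∈_)
open import Data.List.Membership.Propositional.Properties
  using (∈-filter⁺; ∈-allFin; ∈-++⁺ˡ; ∈-++⁺ʳ; ∈-map⁺; ∈-concat⁺′)
open import Data.List.Properties using (length-++)
import Data.List.Relation.Unary.All as All
open import Data.List.Relation.Unary.Any using (here; index)
open import Data.List.Relation.Unary.Any.Properties using (lookup-index)
open import Data.Nat using (suc; zero; _+_; _≤_; _≤?_; z≤n; s≤s; _≤′_; ≤′-refl; ≤′-step)
import Data.Nat.Properties as ℕ
open import Data.Nat.Properties using (≤-refl; ≤-trans; +-mono-≤; ≰⇒>; ≤⇒≤′; <-cmp)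
open import Data.List.Extrema ℕ.≤-totalOrder using (argmax; f[xs]≤f[argmax])
open import Data.Product using (_×_; _,_; proj₁; proj₂)
open import Data.Sum using (_⊎_; inj₁; inj₂; [_,_])
open import Data.Vec.Functional using (Vector; _∷_; []) renaming (_++_ to _++ᵛ_)
import Data.Vec.Functional.Relation.Unary.All.Properties as VectorAll
open import Function using (_∘_; id)
open import Function.Construct.Composition using (injective)
open import Function.Definitions using (Injective)
open import Relation.Binary using (tri<; tri≈; tri>)
open import Relation.Binary.Definitions using (DecidableEquality)
open import Relation.Binary.PropositionalEquality
  using (_≡_; _≢_; refl; sym; trans; cong; subst; module ≡-Reasoning)
open import Relation.Nullary using (Dec; yes; no; contradiction)
open import Relation.Nullary.Decidable using (_×-dec_; _⊎-dec_)
open import Relation.Nullary.Decidable.Core using (T?)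

injection-length : ∀ {A : Set} {m} (g : Fin m → A) → Injective _≡_ _≡_ g →
                   (xs : List A) → (∀ i → g i ∈ xs) → m ≤ length xs
injection-length {m = m} g g-injective xs g∈xs with m ≤? length xs
... | yes m≤∣xs∣ = m≤∣xs∣
... | no m≰∣xs∣ with pigeonhole (≰⇒> m≰∣xs∣) (index ∘ g∈xs)
... | i , j , i<j , same-index = contradiction (g-injective g[i]≡g[j]) (<⇒≢ i<j)
  where
  open ≡-Reasoning
  g[i]≡g[j] : g i ≡ g j
  g[i]≡g[j] = begin
    g i                             ≡⟨ lookup-index (g∈xs i) ⟩
    List.lookup xs (index (g∈xs i)) ≡⟨ cong (List.lookup xs) same-index ⟩
    List.lookup xs (index (g∈xs j)) ≡⟨ sym (lookup-index (g∈xs j)) ⟩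
    g j                             ∎

length-concatMap-≤ : ∀ {A B : Set} (f : A → List B) {M} → (∀ x → length (f x) ≤ M) →
                     ∀ xs → length (concatMap f xs) ≤ length xs * M
length-concatMap-≤ f f≤M List.[]      = z≤n
length-concatMap-≤ f f≤M (x List.∷ xs) = begin
  length (f x ++ concatMap f xs)         ≡⟨ length-++ (f x) ⟩
  length (f x) + length (concatMap f xs) ≤⟨ +-mono-≤ (f≤M x) (length-concatMap-≤ f f≤M xs) ⟩
  _ + length xs * _                      ∎
  where open ℕ.≤-Reasoning

module _ {A : Set} where

  injective-∷ : ∀ {m} {x : A} {xs : Vector A m} →
                Injective _≡_ _≡_ xs → (∀ i → xs i ≢ x) → Injective _≡_ _≡_ (x ∷ xs)
  injective-∷ xs-inj x∉xs {zero}  {zero}  _    = refl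
  injective-∷ xs-inj x∉xs {zero}  {suc j} x≡xj = contradiction (sym x≡xj) (x∉xs j)
  injective-∷ xs-inj x∉xs {suc i} {zero}  xi≡x = contradiction xi≡x (x∉xs i)
  injective-∷ xs-inj x∉xs {suc i} {suc j} eq   = cong suc (xs-inj eq)

  injective-++ : ∀ {m k} {xs : Vector A m} {ys : Vector A k} →
                 Injective _≡_ _≡_ xs → Injective _≡_ _≡_ ys → (∀ i j → xs i ≢ ys j) →
                 Injective _≡_ _≡_ (xs ++ᵛ ys)
  injective-++ {m} {k} {xs} {ys} xs-inj ys-inj disjoint {i} {j} eq = begin
    i                      ≡⟨ sym (join-splitAt m k i) ⟩
    join m k (splitAt m i) ≡⟨ cong (join m k) (sum-injective (splitAt m i) (splitAt m j) eq) ⟩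
    join m k (splitAt m j) ≡⟨ join-splitAt m k j ⟩
    j                      ∎
    where
    open ≡-Reasoning
    sum-injective : ∀ s t → [ xs , ys ] s ≡ [ xs , ys ] t → s ≡ t
    sum-injective (inj₁ s) (inj₁ t) e = cong inj₁ (xs-inj e)
    sum-injective (inj₁ s) (inj₂ t) e = contradiction e (disjoint s t)
    sum-injective (inj₂ s) (inj₁ t) e = contradiction (sym e) (disjoint t s)
    sum-injective (inj₂ s) (inj₂ t) e = cong inj₂ (ys-inj e)

  injection-avoiding : ∀ {m} → DecidableEquality A → (x : Fin (suc m) → A) → Injective _≡_ _≡_ x →
                       (a : A) → ∃ λ (σ : Fin m → Fin (suc m)) → Injective _≡_ _≡_ σ × (∀ i → x (σ i) ≢ a)
  injection-avoiding _≟_ x x-inj a with any? (λ k → x k ≟ a)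
  ... | yes (k , xk≡a) = punchIn k , punchIn-injective k _ _ ,
                         λ i xσi≡a → punchInᵢ≢i k i (x-inj (trans xσi≡a (sym xk≡a)))
  ... | no a∉x         = suc , suc-injective , λ i xi≡a → a∉x (suc i , xi≡a)

walk-preserves : ∀ {n} {H : Graph n} (P : Fin n → Set) → (∀ {u w} → P u → adj H u w ≡ true → P w) →
                 ∀ {x y} → Walk H x y → P x → P y
walk-preserves P closed here          px = px
walk-preserves P closed (step x~y ys) px = walk-preserves P closed ys (closed px x~y)

adjacent⇒≢ : ∀ {n} (H : Graph n) {x y} → adj H x y ≡ true → x ≢ y
adjacent⇒≢ H {x} x~y refl with trans (sym x~y) (irrefl H x)
... | ()

neighbours : ∀ {n} → Graph n → Fin n → List (Fin n)
neighbours {n} H x = filter (λ u → T? (adj H x u)) (List.allFin n)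

∈-neighbours : ∀ {n} (H : Graph n) {x w} → adj H x w ≡ true → w ∈ neighbours H x
∈-neighbours H {x} {w} x~w = ∈-filter⁺ (λ u → T? (adj H x u)) (∈-allFin w) (subst T (sym x~w) _)

module Distance {n} (H : Graph n) (c : Fin n) where

  Within : ℕ → Fin n → Set
  Within zero    w = w ≡ c
  Within (suc k) w = Within k w ⊎ ∃ λ u → Within k u × adj H u w ≡ true

  AtDistance : ℕ → Fin n → Set
  AtDistance zero    w = w ≡ c
  AtDistance (suc k) w = Within (suc k) w × ¬ Within k w

  within? : ∀ k w → Dec (Within k w)
  within? zero    w = w ≟ᶠ c
  within? (suc k) w = within? k w ⊎-dec any? (λ u → within? k u ×-dec (adj H u w ≟ᵇ true))

  within-mono : ∀ {k m w} → k ≤ m → Within k w → Within m w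
  within-mono = go ∘ ≤⇒≤′
    where
    go : ∀ {k m w} → k ≤′ m → Within k w → Within m w
    go ≤′-refl      = id
    go (≤′-step k≤m) = inj₁ ∘ go k≤m

  at-distance⇒within : ∀ {k w} → AtDistance k w → Within k w
  at-distance⇒within {zero}  = id
  at-distance⇒within {suc k} = proj₁

  within⇒¬farther : ∀ {k m w} → k < m → Within k w → ¬ AtDistance m w
  within⇒¬farther {m = suc m} (s≤s k≤m) w-within (_ , w∉) = w∉ (within-mono k≤m w-within)

  at-distance-unique : ∀ {k m w} → AtDistance k w → AtDistance m w → k ≡ m
  at-distance-unique {k} {m} dk dm with <-cmp k m
  ... | tri< k<m _ _ = contradiction dm (within⇒¬farther k<m (at-distance⇒within dk))
  ... | tri≈ _ k≡m _ = k≡m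
  ... | tri> _ _ m<k = contradiction dk (within⇒¬farther m<k (at-distance⇒within dm))

  at-distance-injective : ∀ {k m} (p : Vector (Fin n) m) →
                          (∀ i → AtDistance (k + toℕ i) (p i)) → Injective _≡_ _≡_ p
  at-distance-injective {k} p p-dist {i} {j} pi≡pj =
    toℕ-injective (ℕ.+-cancelˡ-≡ k _ _ (at-distance-unique (p-dist i) p[i]-at-distance))
    where
    p[i]-at-distance : AtDistance (k + toℕ j) (p i)
    p[i]-at-distance = subst (AtDistance _) (sym pi≡pj) (p-dist j)

  predecessor : ∀ {k w} → AtDistance (suc k) w → ∃ λ u → AtDistance k u × adj H u w ≡ true
  predecessor {k}     (inj₁ w-within       , w∉) = contradiction w-within w∉
  predecessor {zero}  (inj₂ (u , u≡c , u~w) , _) = u , u≡c , u~w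
  predecessor {suc k} (inj₂ (u , u-within , u~w) , w∉) =
    u , (u-within , λ u-nearer → w∉ (inj₂ (u , u-nearer , u~w))) , u~w

  ball : ℕ → List (Fin n)
  ball zero    = List.[ c ]
  ball (suc k) = ball k ++ concatMap (neighbours H) (ball k)

  within⇒∈ball : ∀ {k w} → Within k w → w ∈ ball k
  within⇒∈ball {zero}  refl = here refl
  within⇒∈ball {suc k} (inj₁ w-within) = ∈-++⁺ˡ (within⇒∈ball w-within)
  within⇒∈ball {suc k} (inj₂ (u , u-within , u~w)) =
    ∈-++⁺ʳ (ball k) (∈-concat⁺′ (∈-neighbours H u~w) (∈-map⁺ (neighbours H) (within⇒∈ball u-within)))

  length-ball : ∀ {Δ} → (∀ x → degree H x ≤ Δ) → ∀ k → length (ball k) ≤ (1 + Δ) ^ k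
  length-ball Δ-bound zero         = ≤-refl
  length-ball {Δ} Δ-bound (suc k) = begin
    length (ball k ++ concatMap (neighbours H) (ball k))
      ≡⟨ length-++ (ball k) ⟩
    length (ball k) + length (concatMap (neighbours H) (ball k))
      ≤⟨ +-mono-≤ ≤-refl (length-concatMap-≤ (neighbours H) Δ-bound (ball k)) ⟩
    length (ball k) + length (ball k) * Δ
      ≡⟨ sym (ℕ.*-suc (length (ball k)) Δ) ⟩
    length (ball k) * (1 + Δ)
      ≤⟨ ℕ.*-monoˡ-≤ (1 + Δ) (length-ball Δ-bound k) ⟩
    (1 + Δ) ^ k * (1 + Δ)
      ≡⟨ ℕ.*-comm ((1 + Δ) ^ k) (1 + Δ) ⟩
    (1 + Δ) ^ suc k
      ∎
    where open ℕ.≤-Reasoning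

[1+m]^3<2*m^7 : ∀ m → 2 ≤ m → (1 + m) ^ 3 < 2 * m ^ 7
[1+m]^3<2*m^7 m@(suc (suc _)) 2≤m@(s≤s (s≤s _)) = begin-strict
  (1 + m) ^ 3   ≤⟨ ℕ.^-monoˡ-≤ 3 1+m≤m^2 ⟩
  (m ^ 2) ^ 3   ≡⟨ ℕ.^-*-assoc m 2 3 ⟩
  m ^ 6         <⟨ ℕ.m<m*n (m ^ 6) m {{ℕ.m^n≢0 m 6}} 2≤m ⟩
  m ^ 6 * m     ≡⟨ ℕ.*-comm (m ^ 6) m ⟩
  m ^ 7         ≤⟨ ℕ.m≤n*m (m ^ 7) 2 ⟩
  2 * m ^ 7     ∎
  where
  open ℕ.≤-Reasoning
  1+m≤m^2 : 1 + m ≤ m ^ 2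
  1+m≤m^2 = begin
    1 + m        ≤⟨ +-mono-≤ {1} {m} (s≤s z≤n) (ℕ.m≤m+n m 0) ⟩
    m + (m + 0)  ≤⟨ ℕ.*-monoˡ-≤ m 2≤m ⟩
    m * m        ≡⟨ cong (m *_) (sym (ℕ.*-identityʳ m)) ⟩
    m ^ 2        ∎

module SparklerFree {n} (H : Graph n) (c : Fin n)
                    (leaf : Vector (Fin n) 4) (leaf-injective : Injective _≡_ _≡_ leaf)
                    (c~leaf : ∀ i → adj H c (leaf i) ≡ true) where

  open Distance H c

  at-distance-four⇒S44 : ∀ {w} → AtDistance 4 w → Contains H S44
  at-distance-four⇒S44 {w} w₄ with predecessor w₄
  ... | u , u₃ , u~w with predecessor u₃
  ... | b , b₂ , b~u with predecessor b₂
  ... | a , a₁ , a~b with predecessor a₁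
  ... | _ , refl , c~a with injection-avoiding _≟ᶠ_ leaf leaf-injective a
  ... | σ , σ-injective , leafσ≢a = sparkler , sparkler-injective , edges
    where
    -- S44 lists the centre, three leaves, and then the path whose first vertex is joined to the centre.
    star : Vector (Fin n) 4
    star = (leaf ∘ σ) ++ᵛ (a ∷ [])

    tail : Vector (Fin n) 3
    tail = b ∷ u ∷ w ∷ []

    sparkler : Vector (Fin n) 8
    sparkler = (c ∷ star) ++ᵛ tail

    c~star : ∀ i → adj H c (star i) ≡ true
    c~star = VectorAll.++⁺ (λ x → adj H c x ≡ true) (c~leaf ∘ σ) (λ { zero → c~a })

    star-injective : Injective _≡_ _≡_ star
    star-injective = injective-++ (injective _≡_ _≡_ _≡_ σ-injective leaf-injective)
                                  (λ { {zero} {zero} _ → refl })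
                                  (λ { i zero → leafσ≢a i })

    tail-at-distance : ∀ i → AtDistance (2 + toℕ i) (tail i)
    tail-at-distance zero             = b₂
    tail-at-distance (suc zero)       = u₃
    tail-at-distance (suc (suc zero)) = w₄

    c∷star-within-one : ∀ i → Within 1 ((c ∷ star) i)
    c∷star-within-one zero    = inj₁ refl
    c∷star-within-one (suc i) = inj₂ (c , refl , c~star i)

    sparkler-injective : Injective _≡_ _≡_ sparkler
    sparkler-injective =
      injective-++ (injective-∷ star-injective (λ i → adjacent⇒≢ H (c~star i) ∘ sym))
                   (at-distance-injective tail tail-at-distance)
                   (λ i j eq → within⇒¬farther (s≤s (s≤s z≤n)) (c∷star-within-one i)
                                                (subst (AtDistance _) (sym eq) (tail-at-distance j)))

    edges : All.All (λ e → adj H (sparkler (proj₁ e)) (sparkler (proj₂ e)) ≡ true) S44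
    edges = c~star zero All.∷ c~star (suc zero) All.∷ c~star (suc (suc zero)) All.∷
            a~b All.∷ b~u All.∷ u~w All.∷ c~star (suc (suc (suc zero))) All.∷ All.[]

  within-three-closed : ¬ Contains H S44 → ∀ {u w} → Within 3 u → adj H u w ≡ true → Within 3 w
  within-three-closed no-S44 {u} {w} u₃ u~w with within? 3 w
  ... | yes w₃ = w₃
  ... | no w∉₃ = contradiction (at-distance-four⇒S44 (inj₂ (u , u₃ , u~w) , w∉₃)) no-S44

lemma3p2 : ∀ {n} (H : Graph n) → Connected H → Contains H K14 → ¬ Contains H S44 →
    ∃ λ (x : Fin n) → v H < 2 * degree H x ^ 7
lemma3p2 {n} H connected (f , f-injective , c~f₁ All.∷ c~f₂ All.∷ c~f₃ All.∷ c~f₄ All.∷ All.[]) no-S44 =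
  hub , (begin-strict
    n                 ≤⟨ injection-length id id (ball 3) (within⇒∈ball ∘ within-three) ⟩
    length (ball 3)   ≤⟨ length-ball degree≤Δ 3 ⟩
    (1 + Δ) ^ 3       <⟨ [1+m]^3<2*m^7 Δ (≤-trans (s≤s (s≤s z≤n)) 4≤Δ) ⟩
    2 * Δ ^ 7         ∎)
  where
  open ℕ.≤-Reasoning

  c : Fin n
  c = f zero

  c~leaf : ∀ i → adj H c (f (suc i)) ≡ true
  c~leaf zero                   = c~f₁
  c~leaf (suc zero)             = c~f₂
  c~leaf (suc (suc zero))       = c~f₃
  c~leaf (suc (suc (suc zero))) = c~f₄

  leaf-injective : Injective _≡_ _≡_ (f ∘ suc)
  leaf-injective = injective _≡_ _≡_ _≡_ suc-injective f-injective

  open Distance H c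
  open SparklerFree H c (f ∘ suc) leaf-injective c~leaf

  within-three : ∀ x → Within 3 x
  within-three x =
    walk-preserves (Within 3) (within-three-closed no-S44) (connected c x) (inj₁ (inj₁ (inj₁ refl)))

  hub : Fin n
  hub = argmax (degree H) c (List.allFin n)

  Δ : ℕ
  Δ = degree H hub

  degree≤Δ : ∀ x → degree H x ≤ Δ
  degree≤Δ x = All.lookup (f[xs]≤f[argmax] {f = degree H} c (List.allFin n)) (∈-allFin x)

  4≤Δ : 4 ≤ Δ
  4≤Δ = ≤-trans (injection-length (f ∘ suc) leaf-injective (neighbours H c) (∈-neighbours H ∘ c~leaf))
                (degree≤Δ c)
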